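{- For every positive integer $n$, $$f_{A_n}(x)=(-1)^{\lfloor\frac{n+1}{2}\rfloor}\,x^n\,f_{T_n}\!\left(\frac{(-1)^{n+1}}{x}\right).$$
   Context: For a square matrix $B$ of order $n$, $f_B(x)=\det(xI_n-B)$. $A_n$ is the $n\times n$ matrix with $(i,j)$ entry $1$ if $i+j\le n+1$ and $0$ otherwise. $T_n$ is the $n\times n$ matrix with $(i,j)$ entry $1$ if $|i-j|=1$ or $(i,j)=(1,1)$, and $0$ otherwise. -}

module Defs where

open import Data.Nat as ℕ using (ℕ; zero; suc)
open import Data.Fin using (Fin; zero; suc; toℕ; punchIn)
open import Data.Bool using (Bool; true; false; if_then_else_; _∨_; _∧_)
open import Data.Rational using (ℚ; 0ℚ; 1ℚ; _+_; _*_; _-_; -_)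
open import Relation.Nullary.Decidable using (⌊_⌋)

Matrix : ℕ → Set
Matrix n = Fin n → Fin n → ℚ

_^ℚ_ : ℚ → ℕ → ℚ
q ^ℚ zero  = 1ℚ
q ^ℚ suc k = q * (q ^ℚ k)

Σ : ∀ n → (Fin n → ℚ) → ℚ
Σ zero    f = 0ℚ
Σ (suc n) f = f zero + Σ n (λ j → f (suc j))

det : ∀ n → Matrix n → ℚ
det zero    M = 1ℚ
det (suc n) M =
  Σ (suc n) (λ j → ((- 1ℚ) ^ℚ toℕ j) * (M zero j *
     det n (λ i k → M (suc i) (punchIn j k))))

I : ∀ n → Matrix n
I n i j = if ⌊ i Data.Fin.≟ j ⌋ then 1ℚ else 0ℚ

charPolyAt : ∀ n → Matrix n → ℚ → ℚ
charPolyAt n B x = det n (λ i j → (x * I n i j) - B i j)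

b2q : Bool → ℚ
b2q true  = 1ℚ
b2q false = 0ℚ

-- A_n : (i,j) entry 1 iff i + j ≤ n + 1 (1-based), i.e. i' + j' + 1 ≤ n (0-based).
A : ∀ n → Matrix n
A n i j = b2q ⌊ suc (toℕ i ℕ.+ toℕ j) ℕ.≤? n ⌋

-- T_n : (i,j) entry 1 iff |i - j| = 1 or (i,j) = (1,1) (1-based).
T : ∀ n → Matrix n
T n i j = b2q (⌊ toℕ i ℕ.≟ suc (toℕ j) ⌋ ∨ ⌊ toℕ j ℕ.≟ suc (toℕ i) ⌋
               ∨ (⌊ toℕ i ℕ.≟ 0 ⌋ ∧ ⌊ toℕ j ℕ.≟ 0 ⌋))

-- Write D n = det (x I − A n) and, for s = ±1, G s n = xⁿ f_{T n}(s / x).  Expanding along the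
-- first row, f_{T n}(y) satisfies p (k+2) = y p (k+1) − p k, so G s (k+2) = s G s (k+1) − x² G s k,
-- and two such steps combine (as s² = 1) into G s (k+4) = (1 − 2x²) G s (k+2) − x⁴ G s k.
-- Expanding x I − A n along its last row, and its bordered leading minor after subtracting the
-- second column from the first, gives D (n+4) = (2x² − 1) D (n+2) − x⁴ D n.  As n grows by 2,
-- s = (−1)ⁿ⁺¹ stays fixed while (−1)^⌊(n+1)/2⌋ changes sign, so both sides of the identity satisfy
-- this last recurrence; they agree for n ≤ 3.

module Submission where

open import Defs
open import Data.Nat as ℕ using (ℕ; suc; _/_)
open import Data.Rational using (ℚ; 1ℚ; _*_; -_; 1/_; NonZero)
open import Relation.Binary.PropositionalEquality using (_≡_)

open import Data.Bool using (true; false; if_then_else_; _∨_; _∧_)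
open import Data.Fin as Fin using (Fin; zero; suc; toℕ; punchIn; punchOut; inject₁; fromℕ)
import Data.Fin.Properties as Finₚ
open import Data.Nat using (zero; _<ᵇ_; _≡ᵇ_)
open import Data.Nat.DivMod using (m/n≡1+[m∸n]/n)
import Data.Nat.Properties as ℕₚ
open import Data.Rational using (0ℚ; _+_; _-_)
open import Data.Rational.Properties
  using ( +-*-commutativeRing; _≟_; +-comm; +-assoc; +-identityˡ; +-identityʳ
        ; *-identityˡ; *-identityʳ; *-zeroʳ; *-distribˡ-+; *-inverseʳ)
open import Data.Empty using (⊥-elim)
open import Function using (_∘_)
open import Level using (0ℓ)
open import Relation.Binary.PropositionalEquality
  using (refl; sym; trans; cong; cong₂; _≢_; module ≡-Reasoning)
open import Relation.Nullary using (yes; no)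
open import Relation.Nullary.Decidable using (does; dec⇒maybe; isYes≗does; dec-true; dec-false)
open import Tactic.RingSolver using (solve-∀)
open import Tactic.RingSolver.Core.AlmostCommutativeRing
  using (AlmostCommutativeRing; fromCommutativeRing)

ℚ-ring : AlmostCommutativeRing 0ℓ 0ℓ
ℚ-ring = fromCommutativeRing +-*-commutativeRing (λ q → dec⇒maybe (0ℚ ≟ q))

sign : ℕ → ℚ
sign k = (- 1ℚ) ^ℚ k

sign-+2 : ∀ k → sign (suc (suc k)) ≡ sign k
sign-+2 k = negate-twice (sign k)
  where
  negate-twice : ∀ c → (- 1ℚ) * ((- 1ℚ) * c) ≡ c
  negate-twice = solve-∀ ℚ-ring

sign-square : ∀ k → sign k * sign k ≡ 1ℚ
sign-square zero    = refl
sign-square (suc k) = trans (square-neg (sign k)) (sign-square k)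
  where
  square-neg : ∀ c → ((- 1ℚ) * c) * ((- 1ℚ) * c) ≡ c * c
  square-neg = solve-∀ ℚ-ring

x*1-0≡x : ∀ x → x * 1ℚ - 0ℚ ≡ x
x*1-0≡x = solve-∀ ℚ-ring

x*1-1≡x-1 : ∀ x → x * 1ℚ - 1ℚ ≡ x - 1ℚ
x*1-1≡x-1 = solve-∀ ℚ-ring

x*0-0≡0 : ∀ x → x * 0ℚ - 0ℚ ≡ 0ℚ
x*0-0≡0 = solve-∀ ℚ-ring

x*0-1≡-1 : ∀ x → x * 0ℚ - 1ℚ ≡ - 1ℚ
x*0-1≡-1 = solve-∀ ℚ-ring

Σ-cong : ∀ n {f g : Fin n → ℚ} → (∀ j → f j ≡ g j) → Σ n f ≡ Σ n g
Σ-cong zero    f≗g = refl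
Σ-cong (suc n) f≗g = cong₂ _+_ (f≗g zero) (Σ-cong n (f≗g ∘ suc))

Σ-zero : ∀ n {f : Fin n → ℚ} → (∀ j → f j ≡ 0ℚ) → Σ n f ≡ 0ℚ
Σ-zero zero    f≗0 = refl
Σ-zero (suc n) f≗0 = cong₂ _+_ (f≗0 zero) (Σ-zero n (f≗0 ∘ suc))

Σ-*ˡ : ∀ n (a : ℚ) (f : Fin n → ℚ) → Σ n (λ j → a * f j) ≡ a * Σ n f
Σ-*ˡ zero    a f = sym (*-zeroʳ a)
Σ-*ˡ (suc n) a f =
  trans (cong (a * f zero +_) (Σ-*ˡ n a (f ∘ suc))) (sym (*-distribˡ-+ a (f zero) _))

Σ-linear : ∀ n (a b : ℚ) (f g : Fin n → ℚ) →
           Σ n (λ j → a * f j + b * g j) ≡ a * Σ n f + b * Σ n g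
Σ-linear zero    a b f g = zero-law a b
  where
  zero-law : ∀ a b → 0ℚ ≡ a * 0ℚ + b * 0ℚ
  zero-law = solve-∀ ℚ-ring
Σ-linear (suc n) a b f g =
  trans (cong (a * f zero + b * g zero +_) (Σ-linear n a b (f ∘ suc) (g ∘ suc)))
        (regroup a b (f zero) (g zero) _ _)
  where
  regroup : ∀ a b u v s t → (a * u + b * v) + (a * s + b * t) ≡ a * (u + s) + b * (v + t)
  regroup = solve-∀ ℚ-ring

Σ-last : ∀ n (f : Fin (suc n) → ℚ) → Σ (suc n) f ≡ Σ n (f ∘ inject₁) + f (fromℕ n)
Σ-last zero    f = +-comm (f zero) 0ℚ
Σ-last (suc n) f =
  trans (cong (f zero +_) (Σ-last n (f ∘ suc))) (sym (+-assoc (f zero) _ _))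

minor : ∀ {n} → Matrix (suc n) → Fin (suc n) → Matrix n
minor M j i k = M (suc i) (punchIn j k)

laplaceTerm : ∀ {n} → Matrix (suc n) → Fin (suc n) → ℚ
laplaceTerm {n} M j = sign (toℕ j) * (M zero j * det n (minor M j))

laplaceTerm-zeroEntry : ∀ {n} (M : Matrix (suc n)) j → M zero j ≡ 0ℚ → laplaceTerm M j ≡ 0ℚ
laplaceTerm-zeroEntry {n} M j M₀ⱼ≡0 =
  trans (cong (λ u → sign (toℕ j) * (u * det n (minor M j))) M₀ⱼ≡0)
        (vanish (sign (toℕ j)) (det n (minor M j)))
  where
  vanish : ∀ s d → s * (0ℚ * d) ≡ 0ℚ
  vanish = solve-∀ ℚ-ring

laplaceTerm-zeroMinor : ∀ {n} (M : Matrix (suc n)) j → det n (minor M j) ≡ 0ℚ →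
                        laplaceTerm M j ≡ 0ℚ
laplaceTerm-zeroMinor M j minor≡0 =
  trans (cong (λ d → sign (toℕ j) * (M zero j * d)) minor≡0) (vanish (sign (toℕ j)) (M zero j))
  where
  vanish : ∀ s u → s * (u * 0ℚ) ≡ 0ℚ
  vanish = solve-∀ ℚ-ring

det-cong : ∀ n {M N : Matrix n} → (∀ i j → M i j ≡ N i j) → det n M ≡ det n N
det-cong zero    M≗N = refl
det-cong (suc n) M≗N = Σ-cong (suc n) λ j →
  cong₂ (λ u d → sign (toℕ j) * (u * d))
        (M≗N zero j) (det-cong n (λ i k → M≗N (suc i) (punchIn j k)))

det₁ : (M : Matrix 1) → det 1 M ≡ M zero zero
det₁ M = collapse (M zero zero)
  where
  collapse : ∀ u → 1ℚ * (u * 1ℚ) + 0ℚ ≡ u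
  collapse = solve-∀ ℚ-ring

det-zeroRow : ∀ n (M : Matrix n) r → (∀ j → M r j ≡ 0ℚ) → det n M ≡ 0ℚ
det-zeroRow (suc n) M zero    row≡0 =
  Σ-zero (suc n) λ j → laplaceTerm-zeroEntry M j (row≡0 j)
det-zeroRow (suc n) M (suc r) row≡0 =
  Σ-zero (suc n) λ j → laplaceTerm-zeroMinor M j
    (det-zeroRow n (minor M j) r (row≡0 ∘ punchIn j))

det-zeroColumn : ∀ n (M : Matrix n) c → (∀ i → M i c ≡ 0ℚ) → det n M ≡ 0ℚ
det-zeroColumn (suc n) M c column≡0 = Σ-zero (suc n) term≡0
  where
  term≡0 : ∀ j → laplaceTerm M j ≡ 0ℚ
  term≡0 j with j Fin.≟ c
  ... | yes refl = laplaceTerm-zeroEntry M j (column≡0 zero)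
  ... | no  j≢c  = laplaceTerm-zeroMinor M j
    (det-zeroColumn n (minor M j) (punchOut j≢c) λ i →
      trans (cong (M (suc i)) (Finₚ.punchIn-punchOut j≢c)) (column≡0 (suc i)))

det-linear-byTerms : ∀ n (M N K : Matrix (suc n)) (a b : ℚ) →
                     (∀ j → laplaceTerm M j ≡ a * laplaceTerm N j + b * laplaceTerm K j) →
                     det (suc n) M ≡ a * det (suc n) N + b * det (suc n) K
det-linear-byTerms n M N K a b terms =
  trans (Σ-cong (suc n) terms) (Σ-linear (suc n) a b (laplaceTerm N) (laplaceTerm K))

laplaceTerm-linearEntry : ∀ {n} (M N K : Matrix (suc n)) (a b : ℚ) j →
  (∀ i k → minor M j i k ≡ minor N j i k) → (∀ i k → minor K j i k ≡ minor N j i k) →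
  M zero j ≡ a * N zero j + b * K zero j →
  laplaceTerm M j ≡ a * laplaceTerm N j + b * laplaceTerm K j
laplaceTerm-linearEntry {n} M N K a b j M≗N K≗N entry = begin
  sign (toℕ j) * (M zero j * det n (minor M j))
    ≡⟨ cong₂ (λ u d → sign (toℕ j) * (u * d)) entry (det-cong n M≗N) ⟩
  sign (toℕ j) * ((a * N zero j + b * K zero j) * det n (minor N j))
    ≡⟨ distrib (sign (toℕ j)) a b (N zero j) (K zero j) (det n (minor N j)) ⟩
  a * laplaceTerm N j + b * (sign (toℕ j) * (K zero j * det n (minor N j)))
    ≡⟨ cong (λ d → a * laplaceTerm N j + b * (sign (toℕ j) * (K zero j * d)))
            (sym (det-cong n K≗N)) ⟩
  a * laplaceTerm N j + b * laplaceTerm K j ∎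
  where
  open ≡-Reasoning
  distrib : ∀ s a b u v d → s * ((a * u + b * v) * d) ≡ a * (s * (u * d)) + b * (s * (v * d))
  distrib = solve-∀ ℚ-ring

laplaceTerm-linearMinor : ∀ {n} (M N K : Matrix (suc n)) (a b : ℚ) j →
  M zero j ≡ N zero j → K zero j ≡ N zero j →
  det n (minor M j) ≡ a * det n (minor N j) + b * det n (minor K j) →
  laplaceTerm M j ≡ a * laplaceTerm N j + b * laplaceTerm K j
laplaceTerm-linearMinor {n} M N K a b j M₀≡N₀ K₀≡N₀ minors = begin
  sign (toℕ j) * (M zero j * det n (minor M j))
    ≡⟨ cong₂ (λ u d → sign (toℕ j) * (u * d)) M₀≡N₀ minors ⟩
  sign (toℕ j) * (N zero j * (a * det n (minor N j) + b * det n (minor K j)))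
    ≡⟨ distrib (sign (toℕ j)) a b (N zero j) (det n (minor N j)) (det n (minor K j)) ⟩
  a * laplaceTerm N j + b * (sign (toℕ j) * (N zero j * det n (minor K j)))
    ≡⟨ cong (λ u → a * laplaceTerm N j + b * (sign (toℕ j) * (u * det n (minor K j))))
            (sym K₀≡N₀) ⟩
  a * laplaceTerm N j + b * laplaceTerm K j ∎
  where
  open ≡-Reasoning
  distrib : ∀ s a b u d e → s * (u * (a * d + b * e)) ≡ a * (s * (u * d)) + b * (s * (u * e))
  distrib = solve-∀ ℚ-ring

det-linearRow : ∀ n (M N K : Matrix n) r (a b : ℚ) →
  (∀ i j → i ≢ r → M i j ≡ N i j) → (∀ i j → i ≢ r → K i j ≡ N i j) →
  (∀ j → M r j ≡ a * N r j + b * K r j) →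
  det n M ≡ a * det n N + b * det n K
det-linearRow (suc n) M N K zero a b M≗N K≗N row =
  det-linear-byTerms n M N K a b λ j → laplaceTerm-linearEntry M N K a b j
    (λ i k → M≗N (suc i) (punchIn j k) λ ())
    (λ i k → K≗N (suc i) (punchIn j k) λ ())
    (row j)
det-linearRow (suc n) M N K (suc r) a b M≗N K≗N row =
  det-linear-byTerms n M N K a b λ j → laplaceTerm-linearMinor M N K a b j
    (M≗N zero j λ ()) (K≗N zero j λ ())
    (det-linearRow n (minor M j) (minor N j) (minor K j) r a b
      (λ i k i≢r → M≗N (suc i) (punchIn j k) (i≢r ∘ Finₚ.suc-injective))
      (λ i k i≢r → K≗N (suc i) (punchIn j k) (i≢r ∘ Finₚ.suc-injective))
      (row ∘ punchIn j))

det-linearColumn : ∀ n (M N K : Matrix n) c (a b : ℚ) →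
  (∀ i k → k ≢ c → M i k ≡ N i k) → (∀ i k → k ≢ c → K i k ≡ N i k) →
  (∀ i → M i c ≡ a * N i c + b * K i c) →
  det n M ≡ a * det n N + b * det n K
det-linearColumn (suc n) M N K c a b M≗N K≗N column =
  det-linear-byTerms n M N K a b term
  where
  term : ∀ j → laplaceTerm M j ≡ a * laplaceTerm N j + b * laplaceTerm K j
  term j with j Fin.≟ c
  ... | yes refl = laplaceTerm-linearEntry M N K a b j
    (λ i k → M≗N (suc i) (punchIn j k) (Finₚ.punchInᵢ≢i j k))
    (λ i k → K≗N (suc i) (punchIn j k) (Finₚ.punchInᵢ≢i j k))
    (column zero)
  ... | no j≢c = laplaceTerm-linearMinor M N K a b j (M≗N zero j j≢c) (K≗N zero j j≢c)
    (det-linearColumn n (minor M j) (minor N j) (minor K j) (punchOut j≢c) a b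
      (λ i k k≢c → M≗N (suc i) (punchIn j k) (punchIn≢c k k≢c))
      (λ i k k≢c → K≗N (suc i) (punchIn j k) (punchIn≢c k k≢c))
      (λ i → trans (cong (M (suc i)) (Finₚ.punchIn-punchOut j≢c))
               (trans (column (suc i))
                 (cong₂ (λ u v → a * N (suc i) u + b * K (suc i) v)
                        (sym (Finₚ.punchIn-punchOut j≢c)) (sym (Finₚ.punchIn-punchOut j≢c))))))
    where
    punchIn≢c : ∀ k → k ≢ punchOut j≢c → punchIn j k ≢ c
    punchIn≢c k k≢c jₖ≡c = k≢c (Finₚ.punchIn-injective j k (punchOut j≢c)
      (trans jₖ≡c (sym (Finₚ.punchIn-punchOut j≢c))))

det-onlyFirstTerm : ∀ n (M : Matrix (suc n)) → (∀ j → laplaceTerm M (suc j) ≡ 0ℚ) →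
                    det (suc n) M ≡ M zero zero * det n (minor M zero)
det-onlyFirstTerm n M rest≡0 =
  trans (cong (laplaceTerm M zero +_) (Σ-zero n rest≡0))
        (collapse (M zero zero) (det n (minor M zero)))
  where
  collapse : ∀ u d → 1ℚ * (u * d) + 0ℚ ≡ u * d
  collapse = solve-∀ ℚ-ring

det-firstRow-head : ∀ n (M : Matrix (suc n)) → (∀ j → M zero (suc j) ≡ 0ℚ) →
                    det (suc n) M ≡ M zero zero * det n (minor M zero)
det-firstRow-head n M row≡0 =
  det-onlyFirstTerm n M λ j → laplaceTerm-zeroEntry M (suc j) (row≡0 j)

det-firstColumn-head : ∀ n (M : Matrix (suc n)) → (∀ i → M (suc i) zero ≡ 0ℚ) →
                       det (suc n) M ≡ M zero zero * det n (minor M zero)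
det-firstColumn-head zero    M _ = det-firstRow-head zero M λ ()
det-firstColumn-head (suc n) M column≡0 =
  det-onlyFirstTerm (suc n) M λ j → laplaceTerm-zeroMinor M (suc j)
    (det-zeroColumn (suc n) (minor M (suc j)) zero column≡0)

det-equalFirstColumns : ∀ n (M : Matrix (suc (suc n))) → (∀ i → M i zero ≡ M i (suc zero)) →
                        det (suc (suc n)) M ≡ 0ℚ
-- The first two terms cancel since their minors agree; the others vanish by induction.
det-equalFirstColumns n M columns = begin
  laplaceTerm M zero + (laplaceTerm M (suc zero) + Σ n (λ j → laplaceTerm M (suc (suc j))))
    ≡⟨ cong₂ (λ t r → laplaceTerm M zero + (t + r)) second-term (Σ-zero n (rest≡0 M columns)) ⟩
  1ℚ * (M zero zero * det₀) + ((- 1ℚ) * 1ℚ * (M zero zero * det₀) + 0ℚ)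
    ≡⟨ cancel (M zero zero) det₀ ⟩
  0ℚ ∎
  where
  open ≡-Reasoning
  det₀ = det (suc n) (minor M zero)
  second-term : laplaceTerm M (suc zero) ≡ (- 1ℚ) * 1ℚ * (M zero zero * det₀)
  second-term = cong₂ (λ u d → (- 1ℚ) * 1ℚ * (u * d)) (sym (columns zero))
    (det-cong (suc n) {minor M (suc zero)} {minor M zero}
      λ { i zero → columns (suc i) ; i (suc k) → refl })
  rest≡0 : ∀ {m} (N : Matrix (suc (suc m))) → (∀ i → N i zero ≡ N i (suc zero)) →
           ∀ j → laplaceTerm N (suc (suc j)) ≡ 0ℚ
  rest≡0 {suc m} N columns′ j = laplaceTerm-zeroMinor N (suc (suc j))
    (det-equalFirstColumns m (minor N (suc (suc j))) (columns′ ∘ suc))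
  cancel : ∀ u d → 1ℚ * (u * d) + ((- 1ℚ) * 1ℚ * (u * d) + 0ℚ) ≡ 0ℚ
  cancel = solve-∀ ℚ-ring

det-firstColumn-twoHeads : ∀ n (M : Matrix (suc (suc n))) → (∀ i → M (suc (suc i)) zero ≡ 0ℚ) →
  det (suc (suc n)) M
    ≡ M zero zero * det (suc n) (minor M zero)
      - M (suc zero) zero * det (suc n) (λ i k → M (punchIn (suc zero) i) (suc k))
-- Every minor along the first row except the first has first column (M 1 0, 0, …, 0)ᵀ.
det-firstColumn-twoHeads n M column≡0 = begin
  laplaceTerm M zero + Σ (suc n) (λ j → laplaceTerm M (suc j))
    ≡⟨ cong (laplaceTerm M zero +_) (Σ-cong (suc n) term) ⟩
  laplaceTerm M zero + Σ (suc n) (λ j → (- M (suc zero) zero) * laplaceTerm W j)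
    ≡⟨ cong (laplaceTerm M zero +_) (Σ-*ˡ (suc n) (- M (suc zero) zero) (laplaceTerm W)) ⟩
  laplaceTerm M zero + (- M (suc zero) zero) * det (suc n) W
    ≡⟨ regroup (M zero zero) (det (suc n) (minor M zero)) (M (suc zero) zero) (det (suc n) W) ⟩
  M zero zero * det (suc n) (minor M zero) - M (suc zero) zero * det (suc n) W ∎
  where
  open ≡-Reasoning
  W : Matrix (suc n)
  W i k = M (punchIn (suc zero) i) (suc k)
  term : ∀ j → laplaceTerm M (suc j) ≡ (- M (suc zero) zero) * laplaceTerm W j
  term j =
    trans (cong (λ d → (- 1ℚ) * sign (toℕ j) * (M zero (suc j) * d))
                (det-firstColumn-head n (minor M (suc j)) column≡0))
          (swap (sign (toℕ j)) (M zero (suc j)) (M (suc zero) zero) (det n (minor W j)))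
    where
    swap : ∀ s u c d → (- 1ℚ) * s * (u * (c * d)) ≡ (- c) * (s * (u * d))
    swap = solve-∀ ℚ-ring
  regroup : ∀ u d c e → 1ℚ * (u * d) + (- c) * e ≡ u * d - c * e
  regroup = solve-∀ ℚ-ring

det-continuant : ∀ n (M : Matrix (suc (suc n))) →
  (∀ j → M zero (suc (suc j)) ≡ 0ℚ) → (∀ i → M (suc (suc i)) zero ≡ 0ℚ) →
  det (suc (suc n)) M
    ≡ M zero zero * det (suc n) (minor M zero)
      - M (suc zero) zero * (M zero (suc zero) * det n (minor (minor M zero) zero))
det-continuant n M row≡0 column≡0 =
  trans (det-firstColumn-twoHeads n M column≡0)
        (cong (λ d → M zero zero * det (suc n) (minor M zero) - M (suc zero) zero * d)
              (det-firstRow-head n (λ i k → M (punchIn (suc zero) i) (suc k)) row≡0))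

punchIn-fromℕ : ∀ {n} (k : Fin n) → punchIn (fromℕ n) k ≡ inject₁ k
punchIn-fromℕ zero    = refl
punchIn-fromℕ (suc k) = cong suc (punchIn-fromℕ k)

punchIn-inject₁ : ∀ {n} (j : Fin (suc n)) (k : Fin n) →
                  punchIn (inject₁ j) (inject₁ k) ≡ inject₁ (punchIn j k)
punchIn-inject₁ zero    k       = refl
punchIn-inject₁ (suc j) zero    = refl
punchIn-inject₁ (suc j) (suc k) = cong suc (punchIn-inject₁ j k)

punchIn-inject₁-fromℕ : ∀ {n} (j : Fin (suc n)) →
                        punchIn (inject₁ j) (fromℕ n) ≡ fromℕ (suc n)
punchIn-inject₁-fromℕ zero            = refl
punchIn-inject₁-fromℕ {suc n} (suc j) = cong suc (punchIn-inject₁-fromℕ j)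

det-lastRow-last : ∀ n (M : Matrix (suc n)) → (∀ j → M (fromℕ n) (inject₁ j) ≡ 0ℚ) →
  det (suc n) M ≡ M (fromℕ n) (fromℕ n) * det n (λ i j → M (inject₁ i) (inject₁ j))
det-lastRow-last zero    M _ = trans (det₁ M) (sym (*-identityʳ (M zero zero)))
det-lastRow-last (suc n) M row≡0 = begin
  det (suc (suc n)) M
    ≡⟨ Σ-last (suc n) (laplaceTerm M) ⟩
  Σ (suc n) (laplaceTerm M ∘ inject₁) + laplaceTerm M (fromℕ (suc n))
    ≡⟨ cong₂ _+_ (Σ-cong (suc n) term) last-term ⟩
  Σ (suc n) (λ j → a * laplaceTerm TL j) + 0ℚ
    ≡⟨ trans (+-identityʳ _) (Σ-*ˡ (suc n) a (laplaceTerm TL)) ⟩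
  a * det (suc n) TL ∎
  where
  open ≡-Reasoning
  a = M (fromℕ (suc n)) (fromℕ (suc n))
  TL : Matrix (suc n)
  TL i j = M (inject₁ i) (inject₁ j)
  last-term : laplaceTerm M (fromℕ (suc n)) ≡ 0ℚ
  last-term = laplaceTerm-zeroMinor M (fromℕ (suc n))
    (det-zeroRow (suc n) (minor M (fromℕ (suc n))) (fromℕ n) λ k →
      trans (cong (M (fromℕ (suc n))) (punchIn-fromℕ k)) (row≡0 k))
  term : ∀ j → laplaceTerm M (inject₁ j) ≡ a * laplaceTerm TL j
  term j = begin
    sign (toℕ (inject₁ j)) * (M zero (inject₁ j) * det (suc n) (minor M (inject₁ j)))
      ≡⟨ cong₂ (λ s d → s * (M zero (inject₁ j) * d))
               (cong sign (Finₚ.toℕ-inject₁ j)) (trans minor-expansion minor-TL) ⟩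
    sign (toℕ j) * (M zero (inject₁ j) * (a * det n (minor TL j)))
      ≡⟨ swap (sign (toℕ j)) (M zero (inject₁ j)) a (det n (minor TL j)) ⟩
    a * laplaceTerm TL j ∎
    where
    minor-expansion : det (suc n) (minor M (inject₁ j))
                      ≡ minor M (inject₁ j) (fromℕ n) (fromℕ n)
                        * det n (λ i k → minor M (inject₁ j) (inject₁ i) (inject₁ k))
    minor-expansion = det-lastRow-last n (minor M (inject₁ j)) λ k →
      trans (cong (M (fromℕ (suc n))) (punchIn-inject₁ j k)) (row≡0 (punchIn j k))
    minor-TL : minor M (inject₁ j) (fromℕ n) (fromℕ n)
               * det n (λ i k → minor M (inject₁ j) (inject₁ i) (inject₁ k))
               ≡ a * det n (minor TL j)
    minor-TL = cong₂ _*_ (cong (M (fromℕ (suc n))) (punchIn-inject₁-fromℕ j))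
                         (det-cong n λ i k → cong (M (suc (inject₁ i))) (punchIn-inject₁ j k))
    swap : ∀ s u a d → s * (u * (a * d)) ≡ a * (s * (u * d))
    swap = solve-∀ ℚ-ring

det-lastRow-head : ∀ n (M : Matrix (suc n)) → (∀ j → M (fromℕ n) (suc j) ≡ 0ℚ) →
  det (suc n) M ≡ sign n * (M (fromℕ n) zero * det n (λ i j → M (inject₁ i) (suc j)))
det-lastRow-head zero    M _ = +-identityʳ _
det-lastRow-head (suc n) M row≡0 = begin
  laplaceTerm M zero + Σ (suc n) (λ j → laplaceTerm M (suc j))
    ≡⟨ cong₂ _+_ first-term (Σ-cong (suc n) term) ⟩
  0ℚ + Σ (suc n) (λ j → c * laplaceTerm Z j)
    ≡⟨ trans (+-identityˡ _) (Σ-*ˡ (suc n) c (laplaceTerm Z)) ⟩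
  c * det (suc n) Z
    ≡⟨ regroup (sign n) b (det (suc n) Z) ⟩
  sign (suc n) * (b * det (suc n) Z) ∎
  where
  open ≡-Reasoning
  b = M (fromℕ (suc n)) zero
  c = (- 1ℚ) * sign n * b
  Z : Matrix (suc n)
  Z i j = M (inject₁ i) (suc j)
  first-term : laplaceTerm M zero ≡ 0ℚ
  first-term = laplaceTerm-zeroMinor M zero (det-zeroRow (suc n) (minor M zero) (fromℕ n) row≡0)
  term : ∀ j → laplaceTerm M (suc j) ≡ c * laplaceTerm Z j
  term j =
    trans (cong (λ d → (- 1ℚ) * sign (toℕ j) * (M zero (suc j) * d))
                (det-lastRow-head n (minor M (suc j)) (row≡0 ∘ punchIn j)))
          (swap (sign (toℕ j)) (sign n) (M zero (suc j)) b (det n (minor Z j)))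
    where
    swap : ∀ s t u b d → (- 1ℚ) * s * (u * (t * (b * d))) ≡ (- 1ℚ) * t * b * (s * (u * d))
    swap = solve-∀ ℚ-ring
  regroup : ∀ t b d → (- 1ℚ) * t * b * d ≡ (- 1ℚ) * t * (b * d)
  regroup = solve-∀ ℚ-ring

det-lastColumn-head : ∀ n (M : Matrix (suc n)) → (∀ i → M (suc i) (fromℕ n) ≡ 0ℚ) →
  det (suc n) M ≡ sign n * (M zero (fromℕ n) * det n (λ i j → M (suc i) (inject₁ j)))
det-lastColumn-head n M column≡0 = begin
  det (suc n) M
    ≡⟨ Σ-last n (laplaceTerm M) ⟩
  Σ n (laplaceTerm M ∘ inject₁) + laplaceTerm M (fromℕ n)
    ≡⟨ cong₂ _+_ (Σ-zero n (term≡0 M column≡0)) last-term ⟩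
  0ℚ + sign n * (M zero (fromℕ n) * det n (λ i j → M (suc i) (inject₁ j)))
    ≡⟨ +-identityˡ _ ⟩
  sign n * (M zero (fromℕ n) * det n (λ i j → M (suc i) (inject₁ j))) ∎
  where
  open ≡-Reasoning
  last-term : laplaceTerm M (fromℕ n)
              ≡ sign n * (M zero (fromℕ n) * det n (λ i j → M (suc i) (inject₁ j)))
  last-term = cong₂ (λ s d → s * (M zero (fromℕ n) * d)) (cong sign (Finₚ.toℕ-fromℕ n))
                    (det-cong n λ i k → cong (M (suc i)) (punchIn-fromℕ k))
  term≡0 : ∀ {m} (N : Matrix (suc m)) → (∀ i → N (suc i) (fromℕ m) ≡ 0ℚ) →
           ∀ j → laplaceTerm N (inject₁ j) ≡ 0ℚ
  term≡0 {suc m} N column≡0′ j = laplaceTerm-zeroMinor N (inject₁ j)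
    (det-zeroColumn (suc m) (minor N (inject₁ j)) (fromℕ m) λ i →
      trans (cong (N (suc i)) (punchIn-inject₁-fromℕ j)) (column≡0′ i))

updateRow : ∀ {n} → Matrix n → Fin n → (Fin n → ℚ) → Matrix n
updateRow M r v i j = if does (i Fin.≟ r) then v j else M i j

updateRow-≢ : ∀ {n} (M : Matrix n) r v {i} j → i ≢ r → updateRow M r v i j ≡ M i j
updateRow-≢ M r v {i} j i≢r rewrite dec-false (i Fin.≟ r) i≢r = refl

updateRow-≡ : ∀ {n} (M : Matrix n) r v j → updateRow M r v r j ≡ v j
updateRow-≡ M r v j rewrite dec-true (r Fin.≟ r) refl = refl

det-updateRow-+ : ∀ n (M : Matrix n) r (u v : Fin n → ℚ) → (∀ j → M r j ≡ u j + v j) →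
                  det n M ≡ det n (updateRow M r u) + det n (updateRow M r v)
det-updateRow-+ n M r u v row = begin
  det n M
    ≡⟨ det-linearRow n M N K r 1ℚ 1ℚ
         (λ i j i≢r → sym (updateRow-≢ M r u j i≢r))
         (λ i j i≢r → trans (updateRow-≢ M r v j i≢r) (sym (updateRow-≢ M r u j i≢r)))
         (λ j → trans (row j) (sym (cong₂ _+_ (trans (*-identityˡ (N r j)) (updateRow-≡ M r u j))
                                              (trans (*-identityˡ (K r j)) (updateRow-≡ M r v j))))) ⟩
  1ℚ * det n N + 1ℚ * det n K
    ≡⟨ cong₂ _+_ (*-identityˡ (det n N)) (*-identityˡ (det n K)) ⟩
  det n N + det n K ∎
  where
  open ≡-Reasoning
  N = updateRow M r u
  K = updateRow M r v

det-lastRow-corners : ∀ n (M : Matrix (suc (suc n))) →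
  (∀ j → M (fromℕ (suc n)) (suc (inject₁ j)) ≡ 0ℚ) →
  det (suc (suc n)) M
    ≡ M (fromℕ (suc n)) (fromℕ (suc n)) * det (suc n) (λ i j → M (inject₁ i) (inject₁ j))
      + sign (suc n) * (M (fromℕ (suc n)) zero * det (suc n) (λ i j → M (inject₁ i) (suc j)))
det-lastRow-corners n M inner≡0 =
  trans (det-updateRow-+ (suc (suc n)) M last tail head split) (cong₂ _+_ det-N det-K)
  where
  last = fromℕ (suc n)
  tail head : Fin (suc (suc n)) → ℚ
  tail zero    = 0ℚ
  tail (suc j) = M last (suc j)
  head zero    = M last zero
  head (suc j) = 0ℚ
  split : ∀ j → M last j ≡ tail j + head j
  split zero    = sym (+-identityˡ (M last zero))
  split (suc j) = sym (+-identityʳ (M last (suc j)))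
  inner≢last : ∀ i → inject₁ i ≢ last
  inner≢last i = Finₚ.fromℕ≢inject₁ ∘ sym
  det-N : det (suc (suc n)) (updateRow M last tail)
          ≡ M last last * det (suc n) (λ i j → M (inject₁ i) (inject₁ j))
  det-N = trans
    (det-lastRow-last (suc n) (updateRow M last tail) λ
      { zero → updateRow-≡ M last tail zero
      ; (suc j) → trans (updateRow-≡ M last tail (suc (inject₁ j))) (inner≡0 j) })
    (cong₂ _*_ (updateRow-≡ M last tail last)
               (det-cong (suc n) λ i j → updateRow-≢ M last tail (inject₁ j) (inner≢last i)))
  det-K : det (suc (suc n)) (updateRow M last head)
          ≡ sign (suc n) * (M last zero * det (suc n) (λ i j → M (inject₁ i) (suc j)))
  det-K = trans
    (det-lastRow-head (suc n) (updateRow M last head) λ j → updateRow-≡ M last head (suc j))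
    (cong₂ (λ u d → sign (suc n) * (u * d)) (updateRow-≡ M last head zero)
           (det-cong (suc n) λ i j → updateRow-≢ M last head (suc j) (inner≢last i)))

Recurrence : ℕ → (ℕ → ℚ) → ℚ → ℚ → Set
Recurrence d u a b = ∀ k → u (d ℕ.+ (d ℕ.+ k)) ≡ a * u (d ℕ.+ k) - b * u k

recurrence-doubling : ∀ u a b → Recurrence 1 u a b → Recurrence 2 u (a * a - (b + b)) (b * b)
recurrence-doubling u a b rec k = begin
  u (4 ℕ.+ k)
    ≡⟨ rec (2 ℕ.+ k) ⟩
  a * u (3 ℕ.+ k) - b * u (2 ℕ.+ k)
    ≡⟨ cong (λ t → a * t - b * u (2 ℕ.+ k)) (rec (1 ℕ.+ k)) ⟩
  a * (a * u (2 ℕ.+ k) - b * u (1 ℕ.+ k)) - b * u (2 ℕ.+ k)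
    ≡⟨ cong (λ t → a * (a * t - b * u (1 ℕ.+ k)) - b * t) (rec k) ⟩
  a * (a * (a * u₁ - b * u₀) - b * u₁) - b * (a * u₁ - b * u₀)
    ≡⟨ expand a b u₁ u₀ ⟩
  (a * a - (b + b)) * (a * u₁ - b * u₀) - b * b * u₀
    ≡⟨ cong (λ t → (a * a - (b + b)) * t - b * b * u₀) (sym (rec k)) ⟩
  (a * a - (b + b)) * u (2 ℕ.+ k) - b * b * u₀ ∎
  where
  open ≡-Reasoning
  u₀ = u k
  u₁ = u (suc k)
  expand : ∀ a b u₁ u₀ → a * (a * (a * u₁ - b * u₀) - b * u₁) - b * (a * u₁ - b * u₀)
                         ≡ (a * a - (b + b)) * (a * u₁ - b * u₀) - b * b * u₀
  expand = solve-∀ ℚ-ring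

recurrence-unique : ∀ u v α β → Recurrence 2 u α β → Recurrence 2 v α β →
                    u 0 ≡ v 0 → u 1 ≡ v 1 → u 2 ≡ v 2 → u 3 ≡ v 3 → ∀ n → u n ≡ v n
recurrence-unique u v α β rec-u rec-v u₀ u₁ u₂ u₃ = agree
  where
  agree : ∀ n → u n ≡ v n
  agree 0 = u₀
  agree 1 = u₁
  agree 2 = u₂
  agree 3 = u₃
  agree (suc (suc (suc (suc n)))) =
    trans (rec-u n) (trans (cong₂ (λ s t → α * s - β * t) (agree (suc (suc n))) (agree n))
                           (sym (rec-v n)))

I-diag : ∀ {n} (i : Fin n) → I n i i ≡ 1ℚ
I-diag i = cong (λ b → if b then 1ℚ else 0ℚ)
  (trans (isYes≗does (i Fin.≟ i)) (dec-true (i Fin.≟ i) refl))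

I-offDiag : ∀ {n} {i j : Fin n} → i ≢ j → I n i j ≡ 0ℚ
I-offDiag {i = i} {j} i≢j = cong (λ b → if b then 1ℚ else 0ℚ)
  (trans (isYes≗does (i Fin.≟ j)) (dec-false (i Fin.≟ j) i≢j))

I-suc : ∀ {n} (i j : Fin n) → I (suc n) (suc i) (suc j) ≡ I n i j
I-suc i j = cong (λ b → if b then 1ℚ else 0ℚ)
  (trans (isYes≗does (suc i Fin.≟ suc j)) (sym (isYes≗does (i Fin.≟ j))))

I-inject₁ : ∀ {n} (i j : Fin n) → I (suc n) (inject₁ i) (inject₁ j) ≡ I n i j
I-inject₁ zero    zero    = refl
I-inject₁ zero    (suc j) = refl
I-inject₁ (suc i) zero    = refl
I-inject₁ (suc i) (suc j) =
  trans (I-suc (inject₁ i) (inject₁ j)) (trans (I-inject₁ i j) (sym (I-suc i j)))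

-- Unlike ⌊_⌋, the boolean _<ᵇ_ reduces on successors.
A-bool : ∀ n (i j : Fin n) → A n i j ≡ b2q (toℕ i ℕ.+ toℕ j <ᵇ n)
A-bool n i j = cong b2q (isYes≗does (suc (toℕ i ℕ.+ toℕ j) ℕ.≤? n))

toℕ<ᵇ : ∀ {n} (j : Fin n) → (toℕ j <ᵇ n) ≡ true
toℕ<ᵇ zero    = refl
toℕ<ᵇ (suc j) = toℕ<ᵇ j

m+n≮ᵇm : ∀ m n → (m ℕ.+ n <ᵇ m) ≡ false
m+n≮ᵇm zero    n = refl
m+n≮ᵇm (suc m) n = m+n≮ᵇm m n

A-firstRow : ∀ {m} (j : Fin (suc m)) → A (suc m) zero j ≡ 1ℚ
A-firstRow {m} j = trans (A-bool (suc m) zero j) (cong b2q (toℕ<ᵇ j))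

A-firstColumn : ∀ {m} (i : Fin (suc m)) → A (suc m) i zero ≡ 1ℚ
A-firstColumn {m} i = trans (A-bool (suc m) i zero)
  (cong b2q (trans (cong (_<ᵇ suc m) (ℕₚ.+-identityʳ (toℕ i))) (toℕ<ᵇ i)))

A-inner : ∀ {k} (i j : Fin k) → A (suc (suc k)) (suc (inject₁ i)) (suc (inject₁ j)) ≡ A k i j
A-inner {k} i j = trans (A-bool (suc (suc k)) (suc (inject₁ i)) (suc (inject₁ j)))
  (trans (cong (λ t → b2q (t <ᵇ suc k)) shift) (sym (A-bool k i j)))
  where
  shift : toℕ (inject₁ i) ℕ.+ suc (toℕ (inject₁ j)) ≡ suc (toℕ i ℕ.+ toℕ j)
  shift = trans (cong₂ (λ a b → a ℕ.+ suc b) (Finₚ.toℕ-inject₁ i) (Finₚ.toℕ-inject₁ j))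
                (ℕₚ.+-suc (toℕ i) (toℕ j))

A-lastRow : ∀ {m} (j : Fin m) → A (suc m) (fromℕ m) (suc j) ≡ 0ℚ
A-lastRow {m} j = trans (A-bool (suc m) (fromℕ m) (suc j)) (cong b2q
  (trans (cong (_<ᵇ suc m) (trans (cong (ℕ._+ suc (toℕ j)) (Finₚ.toℕ-fromℕ m))
                                  (ℕₚ.+-suc m (toℕ j))))
         (m+n≮ᵇm m (toℕ j))))

A-lastColumn : ∀ {m} (i : Fin m) → A (suc m) (suc i) (fromℕ m) ≡ 0ℚ
A-lastColumn {m} i = trans (A-bool (suc m) (suc i) (fromℕ m)) (cong b2q
  (trans (cong (_<ᵇ m) (trans (cong (toℕ i ℕ.+_) (Finₚ.toℕ-fromℕ m))
                              (ℕₚ.+-comm (toℕ i) m)))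
         (m+n≮ᵇm m (toℕ i))))

T-bool : ∀ n (i j : Fin n) →
  T n i j ≡ b2q ((toℕ i ≡ᵇ suc (toℕ j)) ∨ (toℕ j ≡ᵇ suc (toℕ i))
                 ∨ ((toℕ i ≡ᵇ 0) ∧ (toℕ j ≡ᵇ 0)))
T-bool n i j = cong b2q
  (cong₂ _∨_ (isYes≗does (toℕ i ℕ.≟ suc (toℕ j)))
    (cong₂ _∨_ (isYes≗does (toℕ j ℕ.≟ suc (toℕ i)))
      (cong₂ _∧_ (isYes≗does (toℕ i ℕ.≟ 0)) (isYes≗does (toℕ j ℕ.≟ 0)))))

T-suc : ∀ {k} (i j : Fin k) →
        T (suc (suc k)) (suc (suc i)) (suc (suc j)) ≡ T (suc k) (suc i) (suc j)
T-suc {k} i j = trans (T-bool (suc (suc k)) (suc (suc i)) (suc (suc j)))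
                      (sym (T-bool (suc k) (suc i) (suc j)))

module CharMatrixA (x : ℚ) where

  B : ∀ n → Matrix n
  B n i j = x * I n i j - A n i j

  D : ℕ → ℚ
  D n = det n (B n)

  C : ∀ n → Matrix (suc n)
  C n i j = B (suc (suc n)) (inject₁ i) (inject₁ j)

  F : ℕ → ℚ
  F n = det (suc n) (C n)

  E : ℕ → ℚ
  E n = det n (minor (B (suc n)) zero)

  B-entry : ∀ n (i j : Fin n) {p q} → I n i j ≡ p → A n i j ≡ q → B n i j ≡ x * p - q
  B-entry n i j = cong₂ (λ p q → x * p - q)

  B-head : ∀ {m} → B (suc m) zero zero ≡ x - 1ℚ
  B-head {m} =
    trans (B-entry (suc m) zero zero (I-diag {suc m} zero) (A-firstRow {m} zero)) (x*1-1≡x-1 x)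

  B-firstRow : ∀ {m} (j : Fin m) → B (suc m) zero (suc j) ≡ - 1ℚ
  B-firstRow {m} j =
    trans (B-entry (suc m) zero (suc j) (I-offDiag {i = zero} {suc j} λ ()) (A-firstRow (suc j)))
          (x*0-1≡-1 x)

  B-firstColumn : ∀ {m} (i : Fin m) → B (suc m) (suc i) zero ≡ - 1ℚ
  B-firstColumn {m} i =
    trans (B-entry (suc m) (suc i) zero (I-offDiag {i = suc i} {zero} λ ()) (A-firstColumn (suc i)))
          (x*0-1≡-1 x)

  B-inner : ∀ {k} (i j : Fin k) → B (suc (suc k)) (suc (inject₁ i)) (suc (inject₁ j)) ≡ B k i j
  B-inner {k} i j = B-entry (suc (suc k)) (suc (inject₁ i)) (suc (inject₁ j))
    (trans (I-suc (inject₁ i) (inject₁ j)) (I-inject₁ i j)) (A-inner i j)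

  B-lastRow : ∀ {m} (j : Fin m) → B (suc (suc m)) (fromℕ (suc m)) (suc (inject₁ j)) ≡ 0ℚ
  B-lastRow {m} j =
    trans (B-entry (suc (suc m)) (fromℕ (suc m)) (suc (inject₁ j))
                   (I-offDiag (Finₚ.fromℕ≢inject₁ {i = suc j})) (A-lastRow (inject₁ j)))
          (x*0-0≡0 x)

  B-lastColumn : ∀ {m} (i : Fin m) → B (suc (suc m)) (suc (inject₁ i)) (fromℕ (suc m)) ≡ 0ℚ
  B-lastColumn {m} i =
    trans (B-entry (suc (suc m)) (suc (inject₁ i)) (fromℕ (suc m))
                   (I-offDiag (Finₚ.fromℕ≢inject₁ {i = suc i} ∘ sym)) (A-lastColumn (inject₁ i)))
          (x*0-0≡0 x)

  B-lastCorner : ∀ {m} → B (suc (suc m)) (fromℕ (suc m)) (fromℕ (suc m)) ≡ x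
  B-lastCorner {m} =
    trans (B-entry (suc (suc m)) (fromℕ (suc m)) (fromℕ (suc m))
                   (I-diag (fromℕ (suc m))) (A-lastRow (fromℕ m)))
          (x*1-0≡x x)

  D-one : D 1 ≡ x - 1ℚ
  D-one = trans (det₁ (B 1)) (B-head {0})

  F-zero : F 0 ≡ x - 1ℚ
  F-zero = trans (det₁ (C 0)) (B-head {1})

  D-step : ∀ n → D (suc (suc n)) ≡ x * F n - D n
  D-step n = begin
    D (suc (suc n))
      ≡⟨ det-lastRow-corners n (B (suc (suc n))) B-lastRow ⟩
    B (suc (suc n)) (fromℕ (suc n)) (fromℕ (suc n)) * F n
      + sign (suc n) * (B (suc (suc n)) (fromℕ (suc n)) zero * det (suc n) Z)
      ≡⟨ cong₂ (λ a b → a * F n + sign (suc n) * (b * det (suc n) Z))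
               B-lastCorner (B-firstColumn (fromℕ n)) ⟩
    x * F n + sign (suc n) * ((- 1ℚ) * det (suc n) Z)
      ≡⟨ cong (λ d → x * F n + sign (suc n) * ((- 1ℚ) * d)) det-Z ⟩
    x * F n + (- 1ℚ) * sign n * ((- 1ℚ) * (sign n * ((- 1ℚ) * D n)))
      ≡⟨ regroup x (F n) (sign n) (D n) ⟩
    x * F n - sign n * sign n * D n
      ≡⟨ cong (λ s → x * F n - s * D n) (sign-square n) ⟩
    x * F n - 1ℚ * D n
      ≡⟨ cong (λ d → x * F n - d) (*-identityˡ (D n)) ⟩
    x * F n - D n ∎
    where
    open ≡-Reasoning
    Z : Matrix (suc n)
    Z i j = B (suc (suc n)) (inject₁ i) (suc j)
    det-Z : det (suc n) Z ≡ sign n * ((- 1ℚ) * D n)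
    det-Z = trans (det-lastColumn-head n Z B-lastColumn)
                  (cong₂ (λ a d → sign n * (a * d)) (B-firstRow (fromℕ n)) (det-cong n B-inner))
    regroup : ∀ x f s d → x * f + (- 1ℚ) * s * ((- 1ℚ) * (s * ((- 1ℚ) * d))) ≡ x * f - s * s * d
    regroup = solve-∀ ℚ-ring

  E-step : ∀ n → E (suc n) ≡ x * D n
  E-step n =
    trans (det-lastRow-last n (minor (B (suc (suc n))) zero) B-lastRow)
          (cong₂ _*_ B-lastCorner (det-cong n B-inner))

  B⁻ : ∀ n → Matrix (suc n)
  B⁻ n zero    j = - 1ℚ
  B⁻ n (suc i) j = B (suc n) (suc i) j

  det-B⁻ : ∀ n → det (suc n) (B⁻ n) ≡ D (suc n) - x * E n
  det-B⁻ n = begin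
    det (suc n) (B⁻ n)
      ≡⟨ det-linearRow (suc n) (B⁻ n) (B (suc n)) K zero 1ℚ (- x)
                       off-first off-first′ first-row ⟩
    1ℚ * D (suc n) + (- x) * det (suc n) K
      ≡⟨ cong (λ d → 1ℚ * D (suc n) + (- x) * d) (det-firstRow-head n K λ _ → refl) ⟩
    1ℚ * D (suc n) + (- x) * (1ℚ * E n)
      ≡⟨ simplify x (D (suc n)) (E n) ⟩
    D (suc n) - x * E n ∎
    where
    open ≡-Reasoning
    K : Matrix (suc n)
    K zero    zero    = 1ℚ
    K zero    (suc _) = 0ℚ
    K (suc i) j       = B (suc n) (suc i) j
    off-first : ∀ i j → i ≢ zero → B⁻ n i j ≡ B (suc n) i j
    off-first zero    j 0≢0 = ⊥-elim (0≢0 refl)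
    off-first (suc i) j _   = refl
    off-first′ : ∀ i j → i ≢ zero → K i j ≡ B (suc n) i j
    off-first′ zero    j 0≢0 = ⊥-elim (0≢0 refl)
    off-first′ (suc i) j _   = refl
    first-row : ∀ j → - 1ℚ ≡ 1ℚ * B (suc n) zero j + (- x) * K zero j
    first-row zero    = trans (split-head x) (cong (λ b → 1ℚ * b + (- x) * 1ℚ) (sym (B-head {n})))
      where
      split-head : ∀ x → - 1ℚ ≡ 1ℚ * (x - 1ℚ) + (- x) * 1ℚ
      split-head = solve-∀ ℚ-ring
    first-row (suc j) = trans (split-tail x) (cong (λ b → 1ℚ * b + (- x) * 0ℚ) (sym (B-firstRow j)))
      where
      split-tail : ∀ x → - 1ℚ ≡ 1ℚ * (- 1ℚ) + (- x) * 0ℚ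
      split-tail = solve-∀ ℚ-ring
    simplify : ∀ x d e → 1ℚ * d + (- x) * (1ℚ * e) ≡ d - x * e
    simplify = solve-∀ ℚ-ring

  -- Subtracting column 1 from column 0 of C (suc n) leaves the column (x, −x, 0, …, 0)ᵀ.
  C₁ C₂ : ∀ n → Matrix (suc (suc n))
  C₁ n i zero    = C (suc n) i (suc zero)
  C₁ n i (suc k) = C (suc n) i (suc k)
  C₂ n i             (suc k) = C (suc n) i (suc k)
  C₂ n zero          zero    = x
  C₂ n (suc zero)    zero    = - x
  C₂ n (suc (suc _)) zero    = 0ℚ

  C-firstColumn : ∀ n i → C (suc n) i zero ≡ 1ℚ * C₁ n i zero + 1ℚ * C₂ n i zero
  C-firstColumn n zero = begin
    B (suc (suc (suc n))) zero zero   ≡⟨ B-head {suc (suc n)} ⟩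
    x - 1ℚ                            ≡⟨ split x ⟩
    1ℚ * (- 1ℚ) + 1ℚ * x              ≡⟨ cong (λ b → 1ℚ * b + 1ℚ * x)
                                              (sym (B-firstRow {suc (suc n)} zero)) ⟩
    1ℚ * C₁ n zero zero + 1ℚ * x      ∎
    where
    open ≡-Reasoning
    split : ∀ x → x - 1ℚ ≡ 1ℚ * (- 1ℚ) + 1ℚ * x
    split = solve-∀ ℚ-ring
  C-firstColumn n (suc zero) = begin
    B (suc (suc (suc n))) (suc zero) zero   ≡⟨ B-firstColumn {suc (suc n)} zero ⟩
    - 1ℚ                                    ≡⟨ split x ⟩
    1ℚ * (x - 1ℚ) + 1ℚ * (- x)              ≡⟨ cong (λ b → 1ℚ * b + 1ℚ * (- x))
                                                    (sym (trans (B-inner {suc n} zero zero)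
                                                                (B-head {n}))) ⟩
    1ℚ * C₁ n (suc zero) zero + 1ℚ * (- x)  ∎
    where
    open ≡-Reasoning
    split : ∀ x → - 1ℚ ≡ 1ℚ * (x - 1ℚ) + 1ℚ * (- x)
    split = solve-∀ ℚ-ring
  C-firstColumn n (suc (suc i)) =
    trans (B-firstColumn (suc (inject₁ i)))
          (cong (λ b → 1ℚ * b + 1ℚ * 0ℚ) (sym (trans (B-inner (suc i) zero) (B-firstColumn i))))

  det-C₂ : ∀ n → det (suc (suc n)) (C₂ n) ≡ x * D (suc n) - (- x) * (D (suc n) - x * E n)
  det-C₂ n =
    trans (det-firstColumn-twoHeads n (C₂ n) λ _ → refl)
          (cong₂ (λ d e → x * d - (- x) * e)
                 (det-cong (suc n) B-inner) (trans (det-cong (suc n) rows≗B⁻) (det-B⁻ n)))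
    where
    rows≗B⁻ : ∀ i k → C₂ n (punchIn (suc zero) i) (suc k) ≡ B⁻ n i k
    rows≗B⁻ zero    k = B-firstRow (inject₁ k)
    rows≗B⁻ (suc i) k = B-inner (suc i) k

  F-step : ∀ n → F (suc n) ≡ (x + x) * D (suc n) - x * x * E n
  F-step n = begin
    F (suc n)
      ≡⟨ det-linearColumn (suc (suc n)) (C (suc n)) (C₁ n) (C₂ n) zero 1ℚ 1ℚ
                          off-first off-first′ (C-firstColumn n) ⟩
    1ℚ * det (suc (suc n)) (C₁ n) + 1ℚ * det (suc (suc n)) (C₂ n)
      ≡⟨ cong₂ (λ a b → 1ℚ * a + 1ℚ * b)
               (det-equalFirstColumns n (C₁ n) λ _ → refl) (det-C₂ n) ⟩
    1ℚ * 0ℚ + 1ℚ * (x * D (suc n) - (- x) * (D (suc n) - x * E n))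
      ≡⟨ simplify x (D (suc n)) (E n) ⟩
    (x + x) * D (suc n) - x * x * E n ∎
    where
    open ≡-Reasoning
    off-first : ∀ i k → k ≢ zero → C (suc n) i k ≡ C₁ n i k
    off-first i zero    0≢0 = ⊥-elim (0≢0 refl)
    off-first i (suc k) _   = refl
    off-first′ : ∀ i k → k ≢ zero → C₂ n i k ≡ C₁ n i k
    off-first′ i zero    0≢0 = ⊥-elim (0≢0 refl)
    off-first′ i (suc k) _   = refl
    simplify : ∀ x d e → 1ℚ * 0ℚ + 1ℚ * (x * d - (- x) * (d - x * e)) ≡ (x + x) * d - x * x * e
    simplify = solve-∀ ℚ-ring

  D-fourStep : Recurrence 2 D (x * x + x * x - 1ℚ) (x * x * (x * x))
  D-fourStep n = begin
    D (suc (suc (suc (suc n))))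
      ≡⟨ D-step (suc (suc n)) ⟩
    x * F (suc (suc n)) - D (suc (suc n))
      ≡⟨ cong (λ f → x * f - D (suc (suc n))) (F-step (suc n)) ⟩
    x * ((x + x) * D (suc (suc n)) - x * x * E (suc n)) - D (suc (suc n))
      ≡⟨ cong (λ e → x * ((x + x) * D (suc (suc n)) - x * x * e) - D (suc (suc n))) (E-step n) ⟩
    x * ((x + x) * D (suc (suc n)) - x * x * (x * D n)) - D (suc (suc n))
      ≡⟨ regroup x (D (suc (suc n))) (D n) ⟩
    (x * x + x * x - 1ℚ) * D (suc (suc n)) - x * x * (x * x) * D n ∎
    where
    open ≡-Reasoning
    regroup : ∀ x d₂ d₀ → x * ((x + x) * d₂ - x * x * (x * d₀)) - d₂
                          ≡ (x * x + x * x - 1ℚ) * d₂ - x * x * (x * x) * d₀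
    regroup = solve-∀ ℚ-ring

  D-two : D 2 ≡ x * (x - 1ℚ) - 1ℚ
  D-two = trans (D-step 0) (cong (λ f → x * f - 1ℚ) F-zero)

  D-three : D 3 ≡ x * ((x + x) * (x - 1ℚ) - x * x * 1ℚ) - (x - 1ℚ)
  D-three = trans (D-step 1)
    (cong₂ (λ f d → x * f - d)
           (trans (F-step 0) (cong (λ d → (x + x) * d - x * x * 1ℚ) D-one)) D-one)

module CharMatrixT (y : ℚ) where

  -- T (suc k) without its first row and column is the adjacency matrix of the path on k vertices.
  P : ∀ k → Matrix k
  P k i j = y * I k i j - T (suc k) (suc i) (suc j)

  charPolyPath : ℕ → ℚ
  charPolyPath k = det k (P k)

  charPolyT : ℕ → ℚ
  charPolyT n = charPolyAt n (T n) y

  charPolyPath-one : charPolyPath 1 ≡ y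
  charPolyPath-one = trans (det₁ (P 1)) (x*1-0≡x y)

  charPolyT-one : charPolyT 1 ≡ y - 1ℚ
  charPolyT-one = trans (det₁ (λ i j → y * I 1 i j - T 1 i j)) (x*1-1≡x-1 y)

  charPolyPath-step : ∀ k →
    charPolyPath (suc (suc k)) ≡ y * charPolyPath (suc k) - charPolyPath k
  charPolyPath-step k =
    trans (det-continuant k (P (suc (suc k))) (λ _ → x*0-0≡0 y) (λ _ → x*0-0≡0 y))
          (trans (cong₂ (λ d e → (y * 1ℚ - 0ℚ) * d - (y * 0ℚ - 1ℚ) * ((y * 0ℚ - 1ℚ) * e))
                        (det-cong (suc k) λ i j → cong₂ (λ a t → y * a - t) (I-suc i j) (T-suc i j))
                        (det-cong k λ i j → cong₂ (λ a t → y * a - t)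
                          (trans (I-suc (suc i) (suc j)) (I-suc i j))
                          (trans (T-suc (suc i) (suc j)) (T-suc i j))))
                 (simplify y (charPolyPath (suc k)) (charPolyPath k)))
    where
    simplify : ∀ y d e → (y * 1ℚ - 0ℚ) * d - (y * 0ℚ - 1ℚ) * ((y * 0ℚ - 1ℚ) * e)
                         ≡ y * d - e
    simplify = solve-∀ ℚ-ring

  charPolyT-viaPath : ∀ k →
    charPolyT (suc (suc k)) ≡ (y - 1ℚ) * charPolyPath (suc k) - charPolyPath k
  charPolyT-viaPath k =
    trans (det-continuant k (λ i j → y * I (suc (suc k)) i j - T (suc (suc k)) i j)
                          (λ _ → x*0-0≡0 y) (λ _ → x*0-0≡0 y))
          (trans (cong₂ (λ d e → (y * 1ℚ - 1ℚ) * d - (y * 0ℚ - 1ℚ) * ((y * 0ℚ - 1ℚ) * e))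
                        (det-cong (suc k) λ i j → cong (λ a → y * a - T (suc (suc k)) (suc i) (suc j))
                                                       (I-suc i j))
                        (det-cong k λ i j → cong₂ (λ a t → y * a - t)
                          (trans (I-suc (suc i) (suc j)) (I-suc i j)) (T-suc i j)))
                 (simplify y (charPolyPath (suc k)) (charPolyPath k)))
    where
    simplify : ∀ y d e → (y * 1ℚ - 1ℚ) * d - (y * 0ℚ - 1ℚ) * ((y * 0ℚ - 1ℚ) * e)
                         ≡ (y - 1ℚ) * d - e
    simplify = solve-∀ ℚ-ring

  charPolyT-difference : ∀ k → charPolyT (suc k) ≡ charPolyPath (suc k) - charPolyPath k
  charPolyT-difference zero    = trans charPolyT-one (cong (_- 1ℚ) (sym charPolyPath-one))
  charPolyT-difference (suc k) =
    trans (charPolyT-viaPath k)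
          (trans (regroup y (charPolyPath (suc k)) (charPolyPath k))
                 (cong (_- charPolyPath (suc k)) (sym (charPolyPath-step k))))
    where
    regroup : ∀ y d e → (y - 1ℚ) * d - e ≡ (y * d - e) - d
    regroup = solve-∀ ℚ-ring

  charPolyT-step : ∀ k → charPolyT (suc (suc k)) ≡ y * charPolyT (suc k) - charPolyT k
  charPolyT-step zero    =
    trans (charPolyT-viaPath zero)
          (trans (cong (λ q → (y - 1ℚ) * q - 1ℚ) charPolyPath-one)
                 (trans (swap y) (cong (λ t → y * t - 1ℚ) (sym charPolyT-one))))
    where
    swap : ∀ y → (y - 1ℚ) * y - 1ℚ ≡ y * (y - 1ℚ) - 1ℚ
    swap = solve-∀ ℚ-ring
  charPolyT-step (suc k) = begin
    charPolyT (suc (suc (suc k)))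
      ≡⟨ charPolyT-difference (suc (suc k)) ⟩
    q₃ - q₂
      ≡⟨ cong₂ _-_ (charPolyPath-step (suc k)) (charPolyPath-step k) ⟩
    (y * q₂ - q₁) - (y * q₁ - q₀)
      ≡⟨ regroup y q₂ q₁ q₀ ⟩
    y * (q₂ - q₁) - (q₁ - q₀)
      ≡⟨ sym (cong₂ (λ a b → y * a - b) (charPolyT-difference (suc k)) (charPolyT-difference k)) ⟩
    y * charPolyT (suc (suc k)) - charPolyT (suc k) ∎
    where
    open ≡-Reasoning
    q₀ = charPolyPath k
    q₁ = charPolyPath (suc k)
    q₂ = charPolyPath (suc (suc k))
    q₃ = charPolyPath (suc (suc (suc k)))
    regroup : ∀ y c b a → (y * c - b) - (y * b - a) ≡ y * (c - b) - (b - a)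
    regroup = solve-∀ ℚ-ring

module Reciprocal (x w : ℚ) (x·w≡1 : x * w ≡ 1ℚ) where

  open CharMatrixA x using (D; D-one; D-two; D-three; D-fourStep)
  open CharMatrixT using (charPolyT; charPolyT-one; charPolyT-step)

  G : ℚ → ℕ → ℚ
  G s n = x ^ℚ n * charPolyT (s * w) n

  G-one : ∀ s → G s 1 ≡ s - x
  G-one s = begin
    x * 1ℚ * charPolyT (s * w) 1   ≡⟨ cong (x * 1ℚ *_) (charPolyT-one (s * w)) ⟩
    x * 1ℚ * (s * w - 1ℚ)          ≡⟨ expand x w s ⟩
    s * (x * w) - x                ≡⟨ cong (λ t → s * t - x) x·w≡1 ⟩
    s * 1ℚ - x                     ≡⟨ cong (_- x) (*-identityʳ s) ⟩
    s - x                          ∎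
    where
    open ≡-Reasoning
    expand : ∀ x w s → x * 1ℚ * (s * w - 1ℚ) ≡ s * (x * w) - x
    expand = solve-∀ ℚ-ring

  G-step : ∀ s → Recurrence 1 (G s) s (x * x)
  G-step s k = begin
    x * (x * xᵏ) * charPolyT (s * w) (suc (suc k))
      ≡⟨ cong (x * (x * xᵏ) *_) (charPolyT-step (s * w) k) ⟩
    x * (x * xᵏ) * ((s * w) * p₁ - p₀)
      ≡⟨ regroup x w s xᵏ p₁ p₀ ⟩
    s * (x * w) * G s (suc k) - x * x * G s k
      ≡⟨ cong (λ t → s * t * G s (suc k) - x * x * G s k) x·w≡1 ⟩
    s * 1ℚ * G s (suc k) - x * x * G s k
      ≡⟨ cong (λ t → t * G s (suc k) - x * x * G s k) (*-identityʳ s) ⟩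
    s * G s (suc k) - x * x * G s k ∎
    where
    open ≡-Reasoning
    xᵏ = x ^ℚ k
    p₀ = charPolyT (s * w) k
    p₁ = charPolyT (s * w) (suc k)
    regroup : ∀ x w s a p q → x * (x * a) * ((s * w) * p - q)
                              ≡ s * (x * w) * (x * a * p) - x * x * (a * q)
    regroup = solve-∀ ℚ-ring

  G-fourStep : ∀ s → s * s ≡ 1ℚ → Recurrence 2 (G s) (1ℚ - (x * x + x * x)) (x * x * (x * x))
  G-fourStep s s²≡1 k =
    trans (recurrence-doubling (G s) s (x * x) (G-step s) k)
          (cong (λ a → (a - (x * x + x * x)) * G s (2 ℕ.+ k) - x * x * (x * x) * G s k) s²≡1)

  G-two : ∀ s → G s 2 ≡ s * (s - x) - x * x * 1ℚ
  G-two s = trans (G-step s 0) (cong (λ g → s * g - x * x * 1ℚ) (G-one s))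

  G-three : ∀ s → G s 3 ≡ s * (s * (s - x) - x * x * 1ℚ) - x * x * (s - x)
  G-three s = trans (G-step s 1) (cong₂ (λ g h → s * g - x * x * h) (G-two s) (G-one s))

  σ : ℕ → ℚ
  σ n = sign ((n ℕ.+ 1) / 2)

  σ-step : ∀ n → σ (suc (suc n)) ≡ (- 1ℚ) * σ n
  σ-step n = cong sign (m/n≡1+[m∸n]/n {suc (suc (n ℕ.+ 1))} {2} (ℕ.s≤s (ℕ.s≤s ℕ.z≤n)))

  R : ℕ → ℚ
  R n = σ n * G (sign (n ℕ.+ 1)) n

  R-fourStep : Recurrence 2 R (x * x + x * x - 1ℚ) (x * x * (x * x))
  R-fourStep n = begin
    σ (4 ℕ.+ n) * G (sign (4 ℕ.+ n ℕ.+ 1)) (4 ℕ.+ n)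
      ≡⟨ cong₂ (λ a t → a * G t (4 ℕ.+ n))
               (trans (σ-step (2 ℕ.+ n)) (cong ((- 1ℚ) *_) (σ-step n)))
               (trans (sign-+2 (2 ℕ.+ n ℕ.+ 1)) (sign-+2 (n ℕ.+ 1))) ⟩
    (- 1ℚ) * ((- 1ℚ) * σ n) * G s (4 ℕ.+ n)
      ≡⟨ cong ((- 1ℚ) * ((- 1ℚ) * σ n) *_) (G-fourStep s (sign-square (n ℕ.+ 1)) n) ⟩
    (- 1ℚ) * ((- 1ℚ) * σ n) * ((1ℚ - (x * x + x * x)) * G s (2 ℕ.+ n) - x * x * (x * x) * G s n)
      ≡⟨ regroup x (σ n) (G s (2 ℕ.+ n)) (G s n) ⟩
    (x * x + x * x - 1ℚ) * ((- 1ℚ) * σ n * G s (2 ℕ.+ n)) - x * x * (x * x) * R n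
      ≡⟨ cong₂ (λ a t → (x * x + x * x - 1ℚ) * (a * G t (2 ℕ.+ n)) - x * x * (x * x) * R n)
               (sym (σ-step n)) (sym (sign-+2 (n ℕ.+ 1))) ⟩
    (x * x + x * x - 1ℚ) * R (2 ℕ.+ n) - x * x * (x * x) * R n ∎
    where
    open ≡-Reasoning
    s = sign (n ℕ.+ 1)
    regroup : ∀ x c g₂ g₀ →
      (- 1ℚ) * ((- 1ℚ) * c) * ((1ℚ - (x * x + x * x)) * g₂ - x * x * (x * x) * g₀)
      ≡ (x * x + x * x - 1ℚ) * ((- 1ℚ) * c * g₂) - x * x * (x * x) * (c * g₀)
    regroup = solve-∀ ℚ-ring

  D≡R : ∀ n → D n ≡ R n
  D≡R = recurrence-unique D R (x * x + x * x - 1ℚ) (x * x * (x * x)) D-fourStep R-fourStep refl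
    (trans D-one (trans (base₁ x) (cong (sign 1 *_) (sym (G-one (sign 2))))))
    (trans D-two (trans (base₂ x) (cong (sign 1 *_) (sym (G-two (sign 3))))))
    (trans D-three (trans (base₃ x) (cong (sign 2 *_) (sym (G-three (sign 4))))))
    where
    base₁ : ∀ x → x - 1ℚ ≡ sign 1 * (sign 2 - x)
    base₁ = solve-∀ ℚ-ring
    base₂ : ∀ x → x * (x - 1ℚ) - 1ℚ ≡ sign 1 * (sign 3 * (sign 3 - x) - x * x * 1ℚ)
    base₂ = solve-∀ ℚ-ring
    base₃ : ∀ x → x * ((x + x) * (x - 1ℚ) - x * x * 1ℚ) - (x - 1ℚ)
                  ≡ sign 2 * (sign 4 * (sign 4 * (sign 4 - x) - x * x * 1ℚ) - x * x * (sign 4 - x))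
    base₃ = solve-∀ ℚ-ring

lemma4p4 : ∀ (n : ℕ) → 1 ℕ.≤ n → (x : ℚ) → .{{_ : NonZero x}} →
    charPolyAt n (A n) x
      ≡ ((- 1ℚ) ^ℚ ((n ℕ.+ 1) / 2)) * ((x ^ℚ n)
          * charPolyAt n (T n) (((- 1ℚ) ^ℚ (n ℕ.+ 1)) * (1/ x)))
-- The identity also holds for n = 0.
lemma4p4 n _ x = Reciprocal.D≡R x (1/ x) (*-inverseʳ x) n
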